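{- If $G$ is a graph with maximum degree at most $3$ and $\mathrm{mad}(G)<\frac{14}{5}$, then $\chi_l(G^2)\le 7$.
   Context: All graphs are finite and simple. $\mathrm{mad}(G)$, the maximum average degree of $G$, is the maximum of $2|E(H)|/|V(H)|$ over all induced subgraphs $H$ of $G$. The square $G^2$ of $G$ has vertex set $V(G)$, with two vertices adjacent if their distance in $G$ is at most $2$. $\chi_l$ denotes the list chromatic number. -}

module Defs where

open import Data.Bool using (Bool; true; false; _∧_; _∨_; not)
open import Data.Nat using (ℕ; _<_; _≤_; _*_)
open import Data.Fin using (Fin; toℕ)
open import Data.Fin.Properties using (_≟_)
open import Data.List using (List; length; filterᵇ; allFin; cartesianProduct)
open import Data.Bool.ListAction using (any)
open import Data.Product using (Σ; _×_; _,_; proj₁; proj₂; ∃)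
open import Data.List.Membership.Propositional using (_∈_)
open import Data.List.Relation.Unary.Unique.Propositional using (Unique)
open import Relation.Binary.PropositionalEquality using (_≡_; _≢_)
open import Relation.Nullary.Decidable using (⌊_⌋)
open import Data.Nat.Properties using (_<?_)

record Graph (n : ℕ) : Set where
  field
    adj   : Fin n → Fin n → Bool
    sym   : ∀ u v → adj u v ≡ adj v u
    loopless : ∀ v → adj v v ≡ false
open Graph public

degree : ∀ {n} → Graph n → Fin n → ℕ
degree {n} G v = length (filterᵇ (adj G v) (allFin n))

MaxDegree≤ : ∀ {n} → Graph n → ℕ → Set
MaxDegree≤ G d = ∀ v → degree G v ≤ d

Subset : ℕ → Set
Subset n = Fin n → Bool

size : ∀ {n} → Subset n → ℕ
size {n} S = length (filterᵇ S (allFin n))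

-- number of edges of the induced subgraph G[S] (unordered pairs counted once, via u < v)
edgesIn : ∀ {n} → Graph n → Subset n → ℕ
edgesIn {n} G S =
  length (filterᵇ (λ p → ⌊ toℕ (proj₁ p) <? toℕ (proj₂ p) ⌋
                         ∧ S (proj₁ p) ∧ S (proj₂ p) ∧ adj G (proj₁ p) (proj₂ p))
                  (cartesianProduct (allFin n) (allFin n)))

-- mad(G) < p / q  (q > 0): every nonempty induced subgraph H satisfies
-- 2|E(H)| / |V(H)| < p / q, i.e. q * (2 |E(H)|) < p * |V(H)|.
MadLessThan : ∀ {n} → Graph n → ℕ → ℕ → Set
MadLessThan {n} G p q =
  ∀ (S : Subset n) → 0 < size S → q * (2 * edgesIn G S) < p * size S

adj² : ∀ {n} → Graph n → Fin n → Fin n → Bool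
adj² {n} G u v =
  not ⌊ u ≟ v ⌋ ∧ (adj G u v ∨ any (λ w → adj G u w ∧ adj G w v) (allFin n))

ListAssignment : ℕ → ℕ → Set
ListAssignment n k = Σ (Fin n → List ℕ) (λ L → ∀ v → Unique (L v) × k ≤ length (L v))

Choosable : ∀ {n} → (Fin n → Fin n → Bool) → ℕ → Set
Choosable {n} A k =
  (L : ListAssignment n k) →
  Σ (Fin n → ℕ) (λ c → (∀ v → c v ∈ proj₁ L v) × (∀ u v → A u v ≡ true → c u ≢ c v))

ListChromaticSquare≤ : ∀ {n} → Graph n → ℕ → Set
ListChromaticSquare≤ G k = Choosable (adj² G) k

-- A graph whose square is 6-degenerate has a 7-choosable square (greedy list
-- colouring), so it suffices that every nonempty vertex set S contains a vertex
-- with at most 6 neighbours in S at distance ≤ 2. Suppose instead that every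
-- v ∈ S has ≥ 7 of them. Since each neighbour y of v reaches at most 3 of them
-- (y and its other ≤ 2 neighbours), every v ∈ S has degree 3 and loses at most 2
-- from the maximum of 9. This forces the neighbours of S to have ≥ 2 neighbours
-- in S, and on H = S ∪ {u : u has ≥ 2 neighbours in S} a discharging argument
-- with initial charge 10·deg_H − 28 shows that H has average degree ≥ 14/5,
-- contradicting mad(G) < 14/5.
module Submission where

open import Defs renaming (sym to adj-sym)
open import Data.Bool using (Bool; true; false; _∧_; _∨_; not; if_then_else_) renaming (_≟_ to _≟𝔹_)
open import Data.Bool.Properties
  using (∧-assoc; ∧-comm; ∧-zeroʳ; ∧-identityʳ; ∨-zeroʳ; ∧-conicalˡ; ∧-conicalʳ; ∨-conicalˡ; not-involutive; T-≡)
open import Data.Bool.ListAction using (any)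
open import Data.Empty using (⊥; ⊥-elim)
open import Data.Fin using (Fin; zero; suc; toℕ)
import Data.Fin.Properties as Finₚ
open Finₚ using (toℕ-injective; any?) renaming (_≟_ to _≟ᶠ_)
open import Data.List using (List; _∷_; _++_; foldr; length; filter; filterᵇ; allFin; tabulate; map; cartesianProduct)
open import Data.List.Properties using (length-++; length-map; filter-++; filter-notAll; map-tabulate; map-cong)
open import Data.List.Membership.Propositional using (_∈_; _∉_)
open import Data.List.Membership.Propositional.Properties using (∈-map⁺; ∈-filter⁺; ∈-allFin)
open import Data.List.Relation.Unary.All as All using ()
open import Data.List.Relation.Unary.Any as Any using (here; there)
open import Data.List.Relation.Unary.AllPairs using (_∷_)
open import Data.List.Relation.Unary.Unique.Propositional using (Unique)
open import Data.Nat using (ℕ; zero; suc; _+_; _*_; _∸_; _≤_; _<_; _≤?_; _<?_; z≤n; s≤s)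
open import Data.Nat.Properties
open import Data.Product using (Σ; ∃; _×_; _,_; proj₁; proj₂)
open import Data.Sum using (_⊎_; inj₁; inj₂)
open import Function using (_∘_; id)
open import Function.Bundles using (_⇔_; mk⇔; Equivalence)
open import Algebra.Properties.Semiring.Sum +-*-semiring
  using (sum; sum-cong-≗; ∑-distrib-+; ∑-comm; *-distribˡ-sum; sum-replicate-zero)
open import Relation.Binary.Definitions using (DecidableEquality)
open import Relation.Binary.PropositionalEquality
open import Relation.Nullary using (¬_; ¬?; Dec; yes; no)
open import Relation.Nullary.Decidable using (⌊_⌋; isYes≗does; dec-true; dec-false; does-⇔; T?; _×-dec_)

𝟙 : Bool → ℕ
𝟙 true  = 1
𝟙 false = 0

𝟙≤1 : ∀ b → 𝟙 b ≤ 1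
𝟙≤1 true  = ≤-refl
𝟙≤1 false = z≤n

𝟙-≤ : ∀ b {m} → (b ≡ true → 1 ≤ m) → 𝟙 b ≤ m
𝟙-≤ true  h = h refl
𝟙-≤ false h = z≤n

*𝟙-≤ : ∀ k b {m} → (b ≡ true → k ≤ m) → k * 𝟙 b ≤ m
*𝟙-≤ k true  h = ≤-trans (≤-reflexive (*-identityʳ k)) (h refl)
*𝟙-≤ k false h = ≤-trans (≤-reflexive (*-zeroʳ k)) z≤n

𝟙*-monoʳ-≤ : ∀ b {m o} → (b ≡ true → m ≤ o) → 𝟙 b * m ≤ 𝟙 b * o
𝟙*-monoʳ-≤ true  h = +-monoˡ-≤ 0 (h refl)
𝟙*-monoʳ-≤ false h = z≤n

𝟙-split : ∀ a b → 𝟙 a ≡ 𝟙 (a ∧ not b) + 𝟙 b * 𝟙 a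
𝟙-split true  true  = refl
𝟙-split true  false = refl
𝟙-split false true  = refl
𝟙-split false false = refl

witness : ∀ {p} {P : Set p} (P? : Dec P) → ⌊ P? ⌋ ≡ true → P
witness (yes p) _ = p

⌊⌋-true : ∀ {p} {P : Set p} (P? : Dec P) → P → ⌊ P? ⌋ ≡ true
⌊⌋-true P? p = trans (isYes≗does P?) (dec-true P? p)

⌊⌋-false : ∀ {p} {P : Set p} (P? : Dec P) → ¬ P → ⌊ P? ⌋ ≡ false
⌊⌋-false P? ¬p = trans (isYes≗does P?) (dec-false P? ¬p)

⌊⌋-⇔ : ∀ {p q} {P : Set p} {Q : Set q} → P ⇔ Q → (P? : Dec P) (Q? : Dec Q) → ⌊ P? ⌋ ≡ ⌊ Q? ⌋
⌊⌋-⇔ P⇔Q P? Q? = trans (isYes≗does P?) (trans (does-⇔ P⇔Q P? Q?) (sym (isYes≗does Q?)))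

∨-true : ∀ {a b} → a ∨ b ≡ true → a ≡ true ⊎ b ≡ true
∨-true {true}  _ = inj₁ refl
∨-true {false} e = inj₂ e

not-true : ∀ {a} → not a ≡ true → a ≡ false
not-true {a} e = trans (sym (not-involutive a)) (cong not e)

sum-mono-≤ : ∀ {n} {f g : Fin n → ℕ} → (∀ i → f i ≤ g i) → sum f ≤ sum g
sum-mono-≤ {zero}  f≤g = z≤n
sum-mono-≤ {suc n} f≤g = +-mono-≤ (f≤g zero) (sum-mono-≤ (f≤g ∘ suc))

term≤sum : ∀ {n} (f : Fin n → ℕ) i → f i ≤ sum f
term≤sum f zero    = m≤m+n (f zero) _
term≤sum f (suc i) = ≤-trans (term≤sum (f ∘ suc) i) (m≤n+m _ (f zero))

_≡ᵇ_ : ∀ {n} → Fin n → Fin n → Bool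
i ≡ᵇ j = ⌊ i ≟ᶠ j ⌋

≡ᵇ-sym : ∀ {n} (i j : Fin n) → (i ≡ᵇ j) ≡ (j ≡ᵇ i)
≡ᵇ-sym i j = ⌊⌋-⇔ (mk⇔ sym sym) (i ≟ᶠ j) (j ≟ᶠ i)

≡ᵇ-suc : ∀ {n} (i j : Fin n) → (suc i ≡ᵇ suc j) ≡ (i ≡ᵇ j)
≡ᵇ-suc i j = ⌊⌋-⇔ (mk⇔ Finₚ.suc-injective (cong suc)) (suc i ≟ᶠ suc j) (i ≟ᶠ j)

sum-δ : ∀ {n} (h : Fin n → ℕ) x → sum (λ i → 𝟙 (i ≡ᵇ x) * h i) ≡ h x
sum-δ {suc n} h zero =
  trans (cong₂ _+_ (+-identityʳ (h zero)) (sum-replicate-zero n)) (+-identityʳ (h zero))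
sum-δ {suc n} h (suc x) =
  trans (sum-cong-≗ λ i → cong (λ b → 𝟙 b * h (suc i)) (≡ᵇ-suc i x)) (sum-δ (h ∘ suc) x)

-- discharging: sending ψ x y from x to y, for all pairs at once, preserves the total charge
sum-discharge : ∀ {n} (a b : Fin n → ℕ) (ψ : Fin n → Fin n → ℕ) →
  (∀ x → a x + sum (ψ x) ≤ b x + sum (λ y → ψ y x)) → sum a ≤ sum b
sum-discharge a b ψ local = +-cancelʳ-≤ (sum (sum ∘ ψ)) (sum a) (sum b) (begin
  sum a + sum (sum ∘ ψ)                       ≡⟨ ∑-distrib-+ a (sum ∘ ψ) ⟨
  sum (λ x → a x + sum (ψ x))                 ≤⟨ sum-mono-≤ local ⟩
  sum (λ x → b x + sum (λ y → ψ y x))         ≡⟨ ∑-distrib-+ b _ ⟩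
  sum b + sum (λ x → sum (λ y → ψ y x))       ≡⟨ cong (sum b +_) (∑-comm (λ x y → ψ y x)) ⟩
  sum b + sum (sum ∘ ψ)                       ∎)
  where open ≤-Reasoning

count : ∀ {n} → Subset n → ℕ
count P = sum (𝟙 ∘ P)

_∩_ : ∀ {n} → Subset n → Subset n → Subset n
(P ∩ Q) i = P i ∧ Q i

_─_ : ∀ {n} → Subset n → Fin n → Subset n
(P ─ x) i = P i ∧ not (i ≡ᵇ x)

─-intro : ∀ {n} (P : Subset n) {x i} → P i ≡ true → (i ≡ᵇ x) ≡ false → (P ─ x) i ≡ true
─-intro P Pi i≢x rewrite Pi | i≢x = refl

∩-─⊆∩ : ∀ {n} (P Q : Subset n) x i → (P ∩ (Q ─ x)) i ≡ true → (P ∩ Q) i ≡ true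
∩-─⊆∩ P Q x i h with P i | Q i
... | true  | true  = refl
... | true  | false = h
... | false | _     = h

∩-─⊆─ : ∀ {n} (P Q : Subset n) x i → (P ∩ (Q ─ x)) i ≡ true → (P ─ x) i ≡ true
∩-─⊆─ P Q x i h with P i | Q i
... | true  | true  = h
... | true  | false with () ← h
... | false | _     = h

count-cong : ∀ {n} {P Q : Subset n} → (∀ i → P i ≡ Q i) → count P ≡ count Q
count-cong P≗Q = sum-cong-≗ (cong 𝟙 ∘ P≗Q)

count-mono : ∀ {n} (P Q : Subset n) → (∀ i → P i ≡ true → Q i ≡ true) → count P ≤ count Q
count-mono P Q P⊆Q = sum-mono-≤ λ i → 𝟙-≤ (P i) λ Pi → subst (λ b → 1 ≤ 𝟙 b) (sym (P⊆Q i Pi)) ≤-refl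

count-split : ∀ {n} (P : Subset n) x → count P ≡ count (P ─ x) + 𝟙 (P x)
count-split P x = begin
  count P                                             ≡⟨ sum-cong-≗ (λ i → 𝟙-split (P i) (i ≡ᵇ x)) ⟩
  sum (λ i → 𝟙 ((P ─ x) i) + 𝟙 (i ≡ᵇ x) * 𝟙 (P i))    ≡⟨ ∑-distrib-+ (𝟙 ∘ (P ─ x)) (λ i → 𝟙 (i ≡ᵇ x) * 𝟙 (P i)) ⟩
  count (P ─ x) + sum (λ i → 𝟙 (i ≡ᵇ x) * 𝟙 (P i))    ≡⟨ cong (count (P ─ x) +_) (sum-δ (𝟙 ∘ P) x) ⟩
  count (P ─ x) + 𝟙 (P x)                             ∎
  where open ≡-Reasoning

count-─ : ∀ {n} (P : Subset n) {x} → P x ≡ true → count P ≡ suc (count (P ─ x))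
count-─ P {x} Px = trans (count-split P x) (trans (cong (λ b → count (P ─ x) + 𝟙 b) Px) (+-comm (count (P ─ x)) 1))

1≤count : ∀ {n} (P : Subset n) {x} → P x ≡ true → 1 ≤ count P
1≤count P {x} Px = ≤-trans (subst (λ b → 1 ≤ 𝟙 b) (sym Px) ≤-refl) (term≤sum (𝟙 ∘ P) x)

count≥1⇒∃ : ∀ {n} (P : Subset n) → 1 ≤ count P → ∃ λ x → P x ≡ true
count≥1⇒∃ {suc n} P h with P zero in P0
... | true  = zero , P0
... | false = let x , Px = count≥1⇒∃ (P ∘ suc) h in suc x , Px

count≤covers : ∀ {m n} (P : Subset n) (K : Fin m → Fin n → ℕ) →
  (∀ w → P w ≡ true → ∃ λ y → 1 ≤ K y w) → count P ≤ sum (λ y → sum (K y))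
count≤covers P K cover = begin
  count P                          ≤⟨ sum-mono-≤ (λ w → 𝟙-≤ (P w) λ Pw → covered w (cover w Pw)) ⟩
  sum (λ w → sum (λ y → K y w))    ≡⟨ ∑-comm (λ w y → K y w) ⟩
  sum (λ y → sum (K y))            ∎
  where
  open ≤-Reasoning
  covered : ∀ w → (∃ λ y → 1 ≤ K y w) → 1 ≤ sum (λ y → K y w)
  covered w (y , h) = ≤-trans h (term≤sum (λ y → K y w) y)

length-filterᵇ-tabulate : ∀ {A : Set} {n} (p : A → Bool) (f : Fin n → A) →
  length (filterᵇ p (tabulate f)) ≡ sum (λ i → 𝟙 (p (f i)))
length-filterᵇ-tabulate {n = zero}  p f = refl
length-filterᵇ-tabulate {n = suc n} p f with p (f zero)
... | true  = cong suc (length-filterᵇ-tabulate p (f ∘ suc))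
... | false = length-filterᵇ-tabulate p (f ∘ suc)

size≡count : ∀ {n} (P : Subset n) → size P ≡ count P
size≡count P = length-filterᵇ-tabulate P id

length-filterᵇ-cartesianProduct : ∀ {A B : Set} {m n} (p : A × B → Bool) (f : Fin m → A) (g : Fin n → B) →
  length (filterᵇ p (cartesianProduct (tabulate f) (tabulate g))) ≡ sum (λ i → sum (λ j → 𝟙 (p (f i , g j))))
length-filterᵇ-cartesianProduct {m = zero}  p f g = refl
length-filterᵇ-cartesianProduct {m = suc m} p f g = begin
  length (filterᵇ p (row ++ rest))                  ≡⟨ cong length (filter-++ (T? ∘ p) row rest) ⟩
  length (filterᵇ p row ++ filterᵇ p rest)          ≡⟨ length-++ (filterᵇ p row) ⟩
  length (filterᵇ p row) + length (filterᵇ p rest)  ≡⟨ cong₂ _+_ row-count (length-filterᵇ-cartesianProduct p (f ∘ suc) g) ⟩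
  sum (λ j → 𝟙 (p (f zero , g j))) + sum (λ i → sum (λ j → 𝟙 (p (f (suc i) , g j)))) ∎
  where
  open ≡-Reasoning
  row  = map (f zero ,_) (tabulate g)
  rest = cartesianProduct (tabulate (f ∘ suc)) (tabulate g)
  row-count : length (filterᵇ p row) ≡ sum (λ j → 𝟙 (p (f zero , g j)))
  row-count = trans (cong (length ∘ filterᵇ p) (map-tabulate g (f zero ,_))) (length-filterᵇ-tabulate p ((f zero ,_) ∘ g))

module _ {A : Set} (_≟ᴬ_ : DecidableEquality A) where
  open import Data.List.Membership.DecPropositional _≟ᴬ_ using (_∈?_)

  ∃∉-of-length< : ∀ (xs ys : List A) → Unique xs → length ys < length xs → ∃ λ x → x ∈ xs × x ∉ ys
  ∃∉-of-length< (x ∷ xs) ys (x≢xs ∷ xs!) |ys|<|x∷xs| with x ∈? ys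
  ... | no x∉ys = x , here refl , x∉ys
  ... | yes x∈ys =
    let y , y∈xs , y∉ys-x = ∃∉-of-length< xs ys-x xs! |ys-x|<|xs|
    in y , there y∈xs , λ y∈ys → y∉ys-x (∈-filter⁺ (λ z → ¬? (z ≟ᴬ x)) y∈ys (All.lookup x≢xs y∈xs ∘ sym))
    where
    ys-x = filter (λ z → ¬? (z ≟ᴬ x)) ys
    |ys-x|<|xs| : length ys-x < length xs
    |ys-x|<|xs| = ≤-trans (filter-notAll (λ z → ¬? (z ≟ᴬ x)) ys (Any.map (λ x≡z z≢x → z≢x (sym x≡z)) x∈ys))
                          (≤-pred |ys|<|x∷xs|)

Degenerate : ∀ {n} → (Fin n → Fin n → Bool) → ℕ → Set
Degenerate {n} R d = ∀ (S : Subset n) → 1 ≤ count S → ∃ λ v → S v ≡ true × count (R v ∩ S) ≤ d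

module GreedyColouring {n} (R : Fin n → Fin n → Bool)
  (R-sym : ∀ u v → R u v ≡ R v u) (R-irrefl : ∀ v → R v v ≡ false)
  {d} (L : ListAssignment n (suc d)) where

  ColouringOn : Subset n → Set
  ColouringOn S = Σ (Fin n → ℕ) λ c → (∀ v → S v ≡ true → c v ∈ proj₁ L v)
                                    × (∀ u v → S u ≡ true → S v ≡ true → R u v ≡ true → c u ≢ c v)

  colouringOn-empty : ∀ S → count S ≡ 0 → ColouringOn S
  colouringOn-empty S |S|≡0 = (λ _ → 0) , (λ v Sv → ⊥-elim (absent Sv)) , λ u v Su _ _ → ⊥-elim (absent Su)
    where
    absent : ∀ {v} → S v ≡ true → ⊥
    absent Sv with () ← subst (1 ≤_) |S|≡0 (1≤count S Sv)

  extend : ∀ S v → S v ≡ true → count (R v ∩ S) ≤ d → ColouringOn (S ─ v) → ColouringOn S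
  extend S v Sv few (c′ , c′∈L , c′-proper) = c , c∈L , c-proper
    where
    S′ = S ─ v
    used : List ℕ
    used = map c′ (filterᵇ (R v ∩ S′) (allFin n))

    c′∈used : ∀ {w} → S′ w ≡ true → R v w ≡ true → c′ w ∈ used
    c′∈used {w} S′w Rvw = ∈-map⁺ c′ (∈-filter⁺ (T? ∘ (R v ∩ S′)) (∈-allFin w)
                                       (Equivalence.from T-≡ (cong₂ _∧_ Rvw S′w)))

    |used|<|Lv| : length used < length (proj₁ L v)
    |used|<|Lv| = begin-strict
      length used              ≡⟨ trans (length-map c′ (filterᵇ (R v ∩ S′) (allFin n))) (length-filterᵇ-tabulate (R v ∩ S′) id) ⟩
      count (R v ∩ S′)         ≤⟨ count-mono (R v ∩ S′) (R v ∩ S) (∩-─⊆∩ (R v) S v) ⟩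
      count (R v ∩ S)          <⟨ s≤s few ⟩
      suc d                    ≤⟨ proj₂ (proj₂ L v) ⟩
      length (proj₁ L v)       ∎
      where open ≤-Reasoning

    fresh = ∃∉-of-length< _≟_ (proj₁ L v) used (proj₁ (proj₂ L v)) |used|<|Lv|
    x = proj₁ fresh

    c : Fin n → ℕ
    c w = if w ≡ᵇ v then x else c′ w

    c∈L : ∀ w → S w ≡ true → c w ∈ proj₁ L w
    c∈L w Sw with w ≡ᵇ v in w≟v
    ... | true  = subst (λ z → x ∈ proj₁ L z) (sym (witness (w ≟ᶠ v) w≟v)) (proj₁ (proj₂ fresh))
    ... | false = c′∈L w (─-intro S Sw w≟v)

    c-proper : ∀ u w → S u ≡ true → S w ≡ true → R u w ≡ true → c u ≢ c w
    c-proper u w Su Sw Ruw with u ≡ᵇ v in u≟v | w ≡ᵇ v in w≟v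
    ... | true  | true  with () ← trans (sym Ruw) (subst₂ (λ a b → R a b ≡ false)
                                    (sym (witness (u ≟ᶠ v) u≟v)) (sym (witness (w ≟ᶠ v) w≟v)) (R-irrefl v))
    ... | true  | false = λ x≡c′w → proj₂ (proj₂ fresh) (subst (_∈ used) (sym x≡c′w)
                            (c′∈used (─-intro S Sw w≟v) (subst (λ a → R a w ≡ true) (witness (u ≟ᶠ v) u≟v) Ruw)))
    ... | false | true  = λ c′u≡x → proj₂ (proj₂ fresh) (subst (_∈ used) c′u≡x
                            (c′∈used (─-intro S Su u≟v)
                              (subst (λ a → R a u ≡ true) (witness (w ≟ᶠ v) w≟v) (trans (R-sym w u) Ruw))))
    ... | false | false = c′-proper u w (─-intro S Su u≟v) (─-intro S Sw w≟v) Ruw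

  colour : Degenerate R d → ∀ m S → count S ≡ m → ColouringOn S
  colour degenerate zero    S |S|≡0 = colouringOn-empty S |S|≡0
  colour degenerate (suc m) S |S|≡1+m with degenerate S (subst (1 ≤_) (sym |S|≡1+m) (s≤s z≤n))
  ... | v , Sv , few =
    extend S v Sv few (colour degenerate m (S ─ v) (suc-injective (trans (sym (count-─ S Sv)) |S|≡1+m)))

greedy-choosable : ∀ {n} (R : Fin n → Fin n → Bool) → (∀ u v → R u v ≡ R v u) → (∀ v → R v v ≡ false) →
  ∀ {d} → Degenerate R d → Choosable R (suc d)
greedy-choosable {n} R R-sym R-irrefl degenerate L =
  let c , c∈L , c-proper = colour degenerate (count full) full refl
  in c , (λ v → c∈L v refl) , λ u v → c-proper u v refl refl
  where
  open GreedyColouring R R-sym R-irrefl L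
  full : Subset n
  full _ = true

any-tabulate⇒∃ : ∀ {A : Set} {n} (p : A → Bool) (f : Fin n → A) → any p (tabulate f) ≡ true → ∃ λ i → p (f i) ≡ true
any-tabulate⇒∃ {n = suc n} p f h with p (f zero) in p0
... | true  = zero , p0
... | false = let i , pi = any-tabulate⇒∃ p (f ∘ suc) h in suc i , pi

module _ {n} (G : Graph n) where

  deg : Fin n → ℕ
  deg u = count (adj G u)

  neighboursIn : Subset n → Fin n → ℕ
  neighboursIn S u = count (adj G u ∩ S)

  sqNeighboursIn : Subset n → Fin n → ℕ
  sqNeighboursIn S v = count (adj² G v ∩ S)

  -- the degree of u in the induced subgraph G[S], and 0 if u ∉ S
  degreeIn : Subset n → Fin n → ℕ
  degreeIn S u = count (λ v → S u ∧ S v ∧ adj G u v)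

  degreeIn-of-member : ∀ S {u} → S u ≡ true → degreeIn S u ≡ neighboursIn S u
  degreeIn-of-member S {u} Su = count-cong λ v → trans (cong (λ b → b ∧ S v ∧ adj G u v) Su) (∧-comm (S v) (adj G u v))

  handshake : ∀ S → 2 * edgesIn G S ≡ sum (degreeIn S)
  handshake S = begin
    2 * edgesIn G S                               ≡⟨ cong (λ e → e + (e + 0)) edges≡ ⟩
    sum (sum ∘ E) + (sum (sum ∘ E) + 0)           ≡⟨ cong (sum (sum ∘ E) +_) (trans (+-identityʳ _) (∑-comm E)) ⟩
    sum (sum ∘ E) + sum (λ u → sum (λ v → E v u)) ≡⟨ ∑-distrib-+ (sum ∘ E) (λ u → sum (λ v → E v u)) ⟨
    sum (λ u → sum (E u) + sum (λ v → E v u))     ≡⟨ sum-cong-≗ (λ u → ∑-distrib-+ (E u) (λ v → E v u)) ⟨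
    sum (λ u → sum (λ v → E u v + E v u))         ≡⟨ sum-cong-≗ (λ u → sum-cong-≗ (λ v → split u v)) ⟨
    sum (degreeIn S)                              ∎
    where
    open ≡-Reasoning
    in-S-and-adjacent : Fin n → Fin n → Bool
    in-S-and-adjacent u v = S u ∧ S v ∧ adj G u v
    E : Fin n → Fin n → ℕ
    E u v = 𝟙 (⌊ toℕ u <? toℕ v ⌋ ∧ in-S-and-adjacent u v)
    edges≡ : edgesIn G S ≡ sum (sum ∘ E)
    edges≡ = length-filterᵇ-cartesianProduct (λ (u , v) → ⌊ toℕ u <? toℕ v ⌋ ∧ in-S-and-adjacent u v) id id
    split : ∀ u v → 𝟙 (in-S-and-adjacent u v) ≡ E u v + E v u
    split u v with toℕ u <? toℕ v | toℕ v <? toℕ u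
    ... | yes u<v | yes v<u = ⊥-elim (<-asym u<v v<u)
    ... | yes _   | no _    = sym (+-identityʳ _)
    ... | no _    | yes _   rewrite adj-sym G u v | ∧-comm (S u) (S v ∧ adj G v u)
                                  | ∧-assoc (S v) (adj G v u) (S u) | ∧-comm (adj G v u) (S u) = refl
    ... | no u≮v  | no v≮u  rewrite toℕ-injective (≤-antisym (≮⇒≥ v≮u) (≮⇒≥ u≮v)) | loopless G v
                                  | ∧-zeroʳ (S v) | ∧-zeroʳ (S v) = refl

  adj²-sym : ∀ u v → adj² G u v ≡ adj² G v u
  adj²-sym u v = cong₂ (λ a b → not a ∧ b) (≡ᵇ-sym u v)
    (cong₂ _∨_ (adj-sym G u v) (cong (foldr _∨_ false) (map-cong via-swap (allFin n))))
    where
    via-swap : ∀ w → (adj G u w ∧ adj G w v) ≡ (adj G v w ∧ adj G w u)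
    via-swap w rewrite adj-sym G u w | adj-sym G w v = ∧-comm (adj G w u) (adj G v w)

  adj²-irrefl : ∀ v → adj² G v v ≡ false
  adj²-irrefl v rewrite ⌊⌋-true (v ≟ᶠ v) refl = refl

  adj²⇒ : ∀ {v w} → adj² G v w ≡ true →
    (w ≡ᵇ v) ≡ false × (adj G v w ≡ true ⊎ ∃ λ u → adj G v u ≡ true × adj G u w ≡ true)
  adj²⇒ {v} {w} h = trans (≡ᵇ-sym w v) (not-true (∧-conicalˡ _ _ h)) , paths (∨-true (∧-conicalʳ _ _ h))
    where
    paths : adj G v w ≡ true ⊎ any (λ u → adj G v u ∧ adj G u w) (allFin n) ≡ true →
            adj G v w ≡ true ⊎ ∃ λ u → adj G v u ≡ true × adj G u w ≡ true
    paths (inj₁ vw)  = inj₁ vw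
    paths (inj₂ any) = let u , vuw = any-tabulate⇒∃ _ id any
                       in inj₂ (u , ∧-conicalˡ _ _ vuw , ∧-conicalʳ _ _ vuw)

  -- the vertices of S at distance ≤ 2 from v reached through its neighbour y, possibly overcounted
  reachVia : Subset n → Fin n → Fin n → ℕ
  reachVia S v y = 𝟙 (S y) + neighboursIn (S ─ v) y

  sqNeighboursIn≤ : ∀ S v → sqNeighboursIn S v ≤ sum (λ y → 𝟙 (adj G v y) * reachVia S v y)
  sqNeighboursIn≤ S v = begin
    sqNeighboursIn S v                                     ≤⟨ count≤covers (adj² G v ∩ S) K cover ⟩
    sum (λ y → sum (K y))                                  ≡⟨ sum-cong-≗ K-total ⟩
    sum (λ y → 𝟙 (adj G v y) * reachVia S v y)             ∎
    where
    open ≤-Reasoning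
    through : Fin n → Fin n → ℕ
    through y w = 𝟙 (w ≡ᵇ y) * 𝟙 (S w) + 𝟙 ((adj G y ∩ (S ─ v)) w)
    K : Fin n → Fin n → ℕ
    K y w = 𝟙 (adj G v y) * through y w

    K-total : ∀ y → sum (K y) ≡ 𝟙 (adj G v y) * reachVia S v y
    K-total y = begin-equality
      sum (K y)                                ≡⟨ *-distribˡ-sum (𝟙 (adj G v y)) (through y) ⟨
      𝟙 (adj G v y) * sum (through y)          ≡⟨ cong (𝟙 (adj G v y) *_) through-total ⟩
      𝟙 (adj G v y) * reachVia S v y           ∎
      where
      through-total : sum (through y) ≡ reachVia S v y
      through-total = trans (∑-distrib-+ (λ w → 𝟙 (w ≡ᵇ y) * 𝟙 (S w)) (𝟙 ∘ (adj G y ∩ (S ─ v))))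
                            (cong (_+ neighboursIn (S ─ v) y) (sum-δ (𝟙 ∘ S) y))

    cover : ∀ w → (adj² G v ∩ S) w ≡ true → ∃ λ y → 1 ≤ K y w
    cover w h with adj²⇒ {v} {w} (∧-conicalˡ _ _ h) | ∧-conicalʳ _ _ h
    ... | _ , inj₁ vw | Sw = w , direct (adj G v w) vw (⌊⌋-true (w ≟ᶠ w) refl) Sw
      where
      direct : ∀ a {b c m} → a ≡ true → b ≡ true → c ≡ true → 1 ≤ 𝟙 a * (𝟙 b * 𝟙 c + m)
      direct _ refl refl refl = s≤s z≤n
    ... | w≢v , inj₂ (u , vu , uw) | Sw = u , two-step (adj G v u) vu (cong₂ _∧_ uw (cong₂ _∧_ Sw (cong not w≢v)))
      where
      two-step : ∀ a {d m} → a ≡ true → d ≡ true → 1 ≤ 𝟙 a * (m + 𝟙 d)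
      two-step _ refl refl = ≤-trans (m≤n+m 1 _) (≤-reflexive (sym (+-identityʳ _)))

  neighboursIn-split : ∀ S x y → neighboursIn S y ≡ neighboursIn (S ─ x) y + 𝟙 (adj G y x ∧ S x)
  neighboursIn-split S x y = trans (count-split (adj G y ∩ S) x)
    (cong (_+ 𝟙 (adj G y x ∧ S x)) (count-cong λ w → ∧-assoc (adj G y w) (S w) (not (w ≡ᵇ x))))

  neighboursIn-─+adj≤deg : ∀ S x y → neighboursIn (S ─ x) y + 𝟙 (adj G y x) ≤ deg y
  neighboursIn-─+adj≤deg S x y = begin
    neighboursIn (S ─ x) y + 𝟙 (adj G y x)  ≤⟨ +-monoˡ-≤ _ (count-mono (adj G y ∩ (S ─ x)) (adj G y ─ x) (∩-─⊆─ (adj G y) S x)) ⟩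
    count (adj G y ─ x) + 𝟙 (adj G y x)     ≡⟨ count-split (adj G y) x ⟨
    deg y                                   ∎
    where open ≤-Reasoning

  neighboursIn<deg : ∀ S {y z} → adj G y z ≡ true → S z ≡ false → neighboursIn S y < deg y
  neighboursIn<deg S {y} {z} yz Sz = begin-strict
    neighboursIn S y                     ≤⟨ count-mono (adj G y ∩ S) (adj G y ─ z) ⊆adj─z ⟩
    count (adj G y ─ z)                  <⟨ n<1+n _ ⟩
    suc (count (adj G y ─ z))            ≡⟨ count-─ (adj G y) yz ⟨
    deg y                                ∎
    where
    open ≤-Reasoning
    ⊆adj─z : ∀ w → (adj G y ∩ S) w ≡ true → (adj G y ─ z) w ≡ true
    ⊆adj─z w h = ─-intro (adj G y) (∧-conicalˡ _ _ h) (⌊⌋-false (w ≟ᶠ z) w≢z)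
      where
      w≢z : w ≢ z
      w≢z w≡z with () ← trans (sym (∧-conicalʳ _ _ h)) (trans (cong S w≡z) Sz)

module Discharging {n} (G : Graph n) (S : Subset n)
  (deg≤3 : ∀ v → deg G v ≤ 3) (S-sqdense : ∀ v → S v ≡ true → 7 ≤ sqNeighboursIn G S v) where

  s : Fin n → ℕ
  s = neighboursIn G S

  deficiency : Fin n → ℕ
  deficiency x = sum (λ y → 𝟙 (adj G x y) * (3 ∸ reachVia G S x y))

  others≤2 : ∀ {x y} → adj G x y ≡ true → neighboursIn G (S ─ x) y ≤ 2
  others≤2 {x} {y} xy = +-cancelʳ-≤ 1 _ 2 (≤-trans
    (subst (λ b → neighboursIn G (S ─ x) y + 𝟙 b ≤ deg G y) (trans (adj-sym G y x) xy) (neighboursIn-─+adj≤deg G S x y))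
    (deg≤3 y))

  reachVia≤3 : ∀ {x y} → adj G x y ≡ true → reachVia G S x y ≤ 3
  reachVia≤3 {x} {y} xy = +-mono-≤ (𝟙≤1 (S y)) (others≤2 xy)

  reach+deficiency : ∀ x → sum (λ y → 𝟙 (adj G x y) * reachVia G S x y) + deficiency x ≡ 3 * deg G x
  reach+deficiency x = begin
    sum (λ y → 𝟙 (adj G x y) * reachVia G S x y) + deficiency x
      ≡⟨ ∑-distrib-+ (λ y → 𝟙 (adj G x y) * reachVia G S x y) (λ y → 𝟙 (adj G x y) * (3 ∸ reachVia G S x y)) ⟨
    sum (λ y → 𝟙 (adj G x y) * reachVia G S x y + 𝟙 (adj G x y) * (3 ∸ reachVia G S x y))
      ≡⟨ sum-cong-≗ complement ⟩
    sum (λ y → 3 * 𝟙 (adj G x y))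
      ≡⟨ *-distribˡ-sum 3 (𝟙 ∘ adj G x) ⟨
    3 * deg G x ∎
    where
    open ≡-Reasoning
    complement : ∀ y → 𝟙 (adj G x y) * reachVia G S x y + 𝟙 (adj G x y) * (3 ∸ reachVia G S x y) ≡ 3 * 𝟙 (adj G x y)
    complement y with adj G x y in xy
    ... | false = refl
    ... | true  = trans (cong₂ _+_ (*-identityˡ (reachVia G S x y)) (*-identityˡ (3 ∸ reachVia G S x y)))
                        (m+[n∸m]≡n (reachVia≤3 xy))

  deficit≤deficiency : ∀ {x y} → adj G x y ≡ true → 3 ∸ reachVia G S x y ≤ deficiency x
  deficit≤deficiency {x} {y} xy = ≤-trans (≤-reflexive (sym (*-identityˡ _)))
    (subst (λ b → 𝟙 b * (3 ∸ reachVia G S x y) ≤ deficiency x) xy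
      (term≤sum (λ y → 𝟙 (adj G x y) * (3 ∸ reachVia G S x y)) y))

  outer2 sponsor saturated H : Subset n
  outer2    u = not (S u) ∧ ⌊ s u ≟ 2 ⌋
  sponsor   u = S u ∧ ⌊ 1 ≤? neighboursIn G outer2 u ⌋
  saturated u = S u ∧ ⌊ s u ≟ 3 ⌋
  H         u = S u ∨ ⌊ 2 ≤? s u ⌋

  S⊆H : ∀ {u} → S u ≡ true → H u ≡ true
  S⊆H {u} Su = cong (_∨ ⌊ 2 ≤? s u ⌋) Su

  H-intro : ∀ {u} → 2 ≤ s u → H u ≡ true
  H-intro {u} 2≤s = trans (cong (S u ∨_) (⌊⌋-true (2 ≤? s u) 2≤s)) (∨-zeroʳ (S u))

  sponsor⇒s≤2 : ∀ {y} → sponsor y ≡ true → s y ≤ 2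
  sponsor⇒s≤2 {y} sp =
    let z , yz∧outer2 = count≥1⇒∃ (adj G y ∩ outer2) (witness (1 ≤? _) (∧-conicalʳ _ _ sp))
        outer2z = ∧-conicalʳ (adj G y z) (outer2 z) yz∧outer2
        Sz = not-true (∧-conicalˡ (not (S z)) ⌊ s z ≟ 2 ⌋ outer2z)
    in ≤-pred (≤-trans (neighboursIn<deg G S (∧-conicalˡ (adj G y z) (outer2 z) yz∧outer2) Sz) (deg≤3 y))

  -- Discharging rules: a sponsor sends 4 to each adjacent outer2 vertex,
  -- and a saturated vertex sends 1 to each adjacent sponsor.
  transfer : Fin n → Fin n → ℕ
  transfer x y = 𝟙 (adj G x y) * (𝟙 (saturated x ∧ sponsor y) + 4 * 𝟙 (sponsor x ∧ outer2 y))

  out inn : Fin n → ℕ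
  out x = sum (transfer x)
  inn x = sum (λ y → transfer y x)

  module _ {x} (Sx : S x ≡ true) where

    7≤reach : 7 ≤ sum (λ y → 𝟙 (adj G x y) * reachVia G S x y)
    7≤reach = ≤-trans (S-sqdense x Sx) (sqNeighboursIn≤ G S x)

    deficiency≤2 : deficiency x ≤ 2
    deficiency≤2 = +-cancelˡ-≤ 7 _ 2 (begin
      7 + deficiency x                                            ≤⟨ +-monoˡ-≤ (deficiency x) 7≤reach ⟩
      sum (λ y → 𝟙 (adj G x y) * reachVia G S x y) + deficiency x ≡⟨ reach+deficiency x ⟩
      3 * deg G x                                                 ≤⟨ *-monoʳ-≤ 3 (deg≤3 x) ⟩
      9                                                           ∎)
      where open ≤-Reasoning

    3≤deg : 3 ≤ deg G x
    3≤deg = *-cancelˡ-< 3 2 (deg G x)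
      (≤-trans 7≤reach (≤-trans (m≤m+n _ (deficiency x)) (≤-reflexive (reach+deficiency x))))

    s-neighbour : ∀ {y} → adj G x y ≡ true → s y ≡ suc (neighboursIn G (S ─ x) y)
    s-neighbour {y} xy = trans (neighboursIn-split G S x y)
      (trans (cong (λ b → neighboursIn G (S ─ x) y + 𝟙 b) (cong₂ _∧_ (trans (adj-sym G y x) xy) Sx))
             (+-comm _ 1))

    neighbour∈H : ∀ {y} → adj G x y ≡ true → H y ≡ true
    neighbour∈H {y} xy = by-S (S y) refl
      where
      deficit≤2 : S y ≡ false → 3 ∸ neighboursIn G (S ─ x) y ≤ 2
      deficit≤2 Sy = subst (λ b → 3 ∸ (𝟙 b + neighboursIn G (S ─ x) y) ≤ 2) Sy
                        (≤-trans (deficit≤deficiency xy) deficiency≤2)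
      1≤others : ∀ {k} → 3 ∸ k ≤ 2 → 1 ≤ k
      1≤others {zero}  (s≤s (s≤s ()))
      1≤others {suc k} _ = s≤s z≤n
      by-S : ∀ b → S y ≡ b → H y ≡ true
      by-S true  Sy = S⊆H Sy
      by-S false Sy = H-intro (subst (2 ≤_) (sym (s-neighbour xy)) (s≤s (1≤others (deficit≤2 Sy))))

    3≤neighboursInH : 3 ≤ neighboursIn G H x
    3≤neighboursInH = ≤-trans 3≤deg
      (count-mono (adj G x) (adj G x ∩ H) λ y xy → cong₂ _∧_ xy (neighbour∈H xy))

    sponsor-deficit : ∀ {y} → adj G x y ≡ true → sponsor y ≡ true → 1 ≤ 3 ∸ reachVia G S x y
    sponsor-deficit {y} xy sp = ∸-monoʳ-≤ 3 reach≤2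
      where
      reach≤2 : reachVia G S x y ≤ 2
      reach≤2 = subst (λ b → 𝟙 b + neighboursIn G (S ─ x) y ≤ 2) (sym (∧-conicalˡ _ _ sp))
                      (subst (_≤ 2) (s-neighbour xy) (sponsor⇒s≤2 sp))

    outer2-deficit : ∀ {y} → adj G x y ≡ true → outer2 y ≡ true → 2 ≤ 3 ∸ reachVia G S x y
    outer2-deficit {y} xy o = subst (λ r → 2 ≤ 3 ∸ r) (sym reach≡1) ≤-refl
      where
      reach≡1 : reachVia G S x y ≡ 1
      reach≡1 = cong₂ _+_ (cong 𝟙 (not-true (∧-conicalˡ _ _ o)))
                          (suc-injective (trans (sym (s-neighbour xy)) (witness (s y ≟ 2) (∧-conicalʳ _ _ o))))

    neighbour-balance : ∀ {y} → adj G x y ≡ true → 1 + 𝟙 (outer2 y) ≤ 𝟙 (saturated y) + (3 ∸ reachVia G S x y)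
    neighbour-balance {y} xy = balance (S y) (s-neighbour xy) (others≤2 xy)
      where
      -- m = s y and k = the number of S-neighbours of y other than x
      balance : ∀ b {m k} → m ≡ suc k → k ≤ 2 → 1 + 𝟙 (not b ∧ ⌊ m ≟ 2 ⌋) ≤ 𝟙 (b ∧ ⌊ m ≟ 3 ⌋) + (3 ∸ (𝟙 b + k))
      balance true  {k = 0} refl _ = s≤s z≤n
      balance true  {k = 1} refl _ = s≤s z≤n
      balance true  {k = 2} refl _ = s≤s z≤n
      balance false {k = 0} refl _ = s≤s z≤n
      balance false {k = 1} refl _ = s≤s (s≤s z≤n)
      balance false {k = 2} refl _ = s≤s z≤n
      balance _ {k = suc (suc (suc _))} _ (s≤s (s≤s ()))

    out≤deficiency : sponsor x ≡ false → out x ≤ deficiency x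
    out≤deficiency ¬sp = sum-mono-≤ λ y → 𝟙*-monoʳ-≤ (adj G x y) λ xy → begin
      𝟙 (saturated x ∧ sponsor y) + 4 * 𝟙 (sponsor x ∧ outer2 y)  ≡⟨ cong (λ b → 𝟙 (saturated x ∧ sponsor y) + 4 * 𝟙 (b ∧ outer2 y)) ¬sp ⟩
      𝟙 (saturated x ∧ sponsor y) + 0                             ≡⟨ +-identityʳ (𝟙 (saturated x ∧ sponsor y)) ⟩
      𝟙 (saturated x ∧ sponsor y)                                 ≤⟨ 𝟙-≤ (saturated x ∧ sponsor y)
                                                                       (sponsor-deficit xy ∘ ∧-conicalʳ (saturated x) (sponsor y)) ⟩
      3 ∸ reachVia G S x y                                        ∎
      where open ≤-Reasoning

    sponsor⇒unsaturated : sponsor x ≡ true → saturated x ≡ false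
    sponsor⇒unsaturated sp = trans (cong (_∧ ⌊ s x ≟ 3 ⌋) Sx) (⌊⌋-false (s x ≟ 3) s≢3)
      where
      s≢3 : s x ≢ 3
      s≢3 s≡3 with s≤s (s≤s ()) ← subst (_≤ 2) s≡3 (sponsor⇒s≤2 sp)

    out≤4outer2 : sponsor x ≡ true → out x ≤ 4 * neighboursIn G outer2 x
    out≤4outer2 sp = begin
      out x                                            ≤⟨ sum-mono-≤ gives-to-outer2 ⟩
      sum (λ y → 4 * 𝟙 ((adj G x ∩ outer2) y))         ≡⟨ *-distribˡ-sum 4 (𝟙 ∘ (adj G x ∩ outer2)) ⟨
      4 * neighboursIn G outer2 x                      ∎
      where
      open ≤-Reasoning
      gives-to-outer2 : ∀ y → 𝟙 (adj G x y) * (𝟙 (saturated x ∧ sponsor y) + 4 * 𝟙 (sponsor x ∧ outer2 y))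
                              ≤ 4 * 𝟙 (adj G x y ∧ outer2 y)
      gives-to-outer2 y rewrite sponsor⇒unsaturated sp | sp with adj G x y
      ... | false = z≤n
      ... | true  = ≤-reflexive (+-identityʳ _)

    2outer2≤deficiency : 2 * neighboursIn G outer2 x ≤ deficiency x
    2outer2≤deficiency = begin
      2 * neighboursIn G outer2 x                     ≡⟨ *-distribˡ-sum 2 (𝟙 ∘ (adj G x ∩ outer2)) ⟩
      sum (λ y → 2 * 𝟙 (adj G x y ∧ outer2 y))        ≤⟨ sum-mono-≤ outer2-deficit′ ⟩
      deficiency x                                    ∎
      where
      open ≤-Reasoning
      outer2-deficit′ : ∀ y → 2 * 𝟙 (adj G x y ∧ outer2 y) ≤ 𝟙 (adj G x y) * (3 ∸ reachVia G S x y)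
      outer2-deficit′ y with adj G x y in xy
      ... | false = z≤n
      ... | true  = ≤-trans (*𝟙-≤ 2 (outer2 y) (outer2-deficit xy))
                            (≤-reflexive (sym (*-identityˡ (3 ∸ reachVia G S x y))))

    deg+outer2≤saturated+deficiency :
      deg G x + neighboursIn G outer2 x ≤ neighboursIn G saturated x + deficiency x
    deg+outer2≤saturated+deficiency = begin
      deg G x + neighboursIn G outer2 x
        ≡⟨ ∑-distrib-+ (𝟙 ∘ adj G x) (𝟙 ∘ (adj G x ∩ outer2)) ⟨
      sum (λ y → 𝟙 (adj G x y) + 𝟙 (adj G x y ∧ outer2 y))
        ≤⟨ sum-mono-≤ balance′ ⟩
      sum (λ y → 𝟙 (adj G x y ∧ saturated y) + 𝟙 (adj G x y) * (3 ∸ reachVia G S x y))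
        ≡⟨ ∑-distrib-+ (𝟙 ∘ (adj G x ∩ saturated)) (λ y → 𝟙 (adj G x y) * (3 ∸ reachVia G S x y)) ⟩
      neighboursIn G saturated x + deficiency x ∎
      where
      open ≤-Reasoning
      balance′ : ∀ y → 𝟙 (adj G x y) + 𝟙 (adj G x y ∧ outer2 y)
                       ≤ 𝟙 (adj G x y ∧ saturated y) + 𝟙 (adj G x y) * (3 ∸ reachVia G S x y)
      balance′ y with adj G x y in xy
      ... | false = z≤n
      ... | true  = ≤-trans (neighbour-balance xy)
                            (+-monoʳ-≤ (𝟙 (saturated y)) (≤-reflexive (sym (*-identityˡ (3 ∸ reachVia G S x y)))))

  saturated≤inn : ∀ {x} → sponsor x ≡ true → neighboursIn G saturated x ≤ inn x
  saturated≤inn {x} sp = sum-mono-≤ receives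
    where
    receives : ∀ y → 𝟙 (adj G x y ∧ saturated y)
                     ≤ 𝟙 (adj G y x) * (𝟙 (saturated y ∧ sponsor x) + 4 * 𝟙 (sponsor y ∧ outer2 x))
    receives y rewrite adj-sym G y x | sp | ∧-identityʳ (saturated y) with adj G x y
    ... | false = z≤n
    ... | true  = ≤-trans (m≤m+n _ _) (≤-reflexive (sym (+-identityʳ _)))

  outside⇒out≡0 : ∀ {x} → S x ≡ false → out x ≡ 0
  outside⇒out≡0 {x} Sx = trans (sum-cong-≗ gives-nothing) (sum-replicate-zero n)
    where
    gives-nothing : ∀ y → transfer x y ≡ 0
    gives-nothing y = trans
      (cong₂ (λ a b → 𝟙 (adj G x y) * (𝟙 (a ∧ sponsor y) + 4 * 𝟙 (b ∧ outer2 y)))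
             (cong (_∧ ⌊ s x ≟ 3 ⌋) Sx) (cong (_∧ ⌊ 1 ≤? neighboursIn G outer2 x ⌋) Sx))
      (*-zeroʳ (𝟙 (adj G x y)))

  outer2⇒4s≤inn : ∀ {x} → outer2 x ≡ true → 4 * s x ≤ inn x
  outer2⇒4s≤inn {x} o = begin
    4 * s x                                  ≡⟨ *-distribˡ-sum 4 (𝟙 ∘ (adj G x ∩ S)) ⟩
    sum (λ y → 4 * 𝟙 (adj G x y ∧ S y))      ≤⟨ sum-mono-≤ (λ y → *𝟙-≤ 4 (adj G x y ∧ S y) (receives4 y)) ⟩
    inn x                                    ∎
    where
    open ≤-Reasoning
    four : ∀ a b c {m} → a ≡ true → b ≡ true → c ≡ true → 4 ≤ 𝟙 a * (m + 4 * 𝟙 (b ∧ c))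
    four _ _ _ {m} refl refl refl = ≤-trans (m≤n+m 4 m) (m≤m+n _ 0)
    receives4 : ∀ y → adj G x y ∧ S y ≡ true → 4 ≤ transfer y x
    receives4 y h = four (adj G y x) (sponsor y) (outer2 x) {𝟙 (saturated y ∧ sponsor x)} yx sp o
      where
      yx = trans (adj-sym G y x) (∧-conicalˡ (adj G x y) (S y) h)
      sp = cong₂ _∧_ (∧-conicalʳ (adj G x y) (S y) h) (⌊⌋-true (1 ≤? _) (1≤count (adj G y ∩ outer2) (cong₂ _∧_ yx o)))

  local-sponsorless : ∀ {x} → S x ≡ true → sponsor x ≡ false → 28 + out x ≤ 10 * neighboursIn G H x + inn x
  local-sponsorless {x} Sx ¬sp = begin
    28 + out x                   ≤⟨ +-monoʳ-≤ 28 (≤-trans (out≤deficiency Sx ¬sp) (deficiency≤2 Sx)) ⟩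
    10 * 3                       ≤⟨ *-monoʳ-≤ 10 (3≤neighboursInH Sx) ⟩
    10 * neighboursIn G H x      ≤⟨ m≤m+n _ (inn x) ⟩
    10 * neighboursIn G H x + inn x ∎
    where open ≤-Reasoning

  local-sponsor : ∀ {x} → S x ≡ true → sponsor x ≡ true → 28 + out x ≤ 10 * neighboursIn G H x + inn x
  local-sponsor {x} Sx sp = begin
    28 + out x                        ≤⟨ +-monoʳ-≤ 28 (≤-trans (out≤4outer2 Sx sp) (*-monoʳ-≤ 4 outer2≤1)) ⟩
    10 * 3 + 2                        ≤⟨ +-mono-≤ (*-monoʳ-≤ 10 (3≤neighboursInH Sx)) (≤-trans 2≤saturated (saturated≤inn sp)) ⟩
    10 * neighboursIn G H x + inn x   ∎
    where
    open ≤-Reasoning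
    outer2≤1 : neighboursIn G outer2 x ≤ 1
    outer2≤1 = *-cancelˡ-≤ 2 (≤-trans (2outer2≤deficiency Sx) (deficiency≤2 Sx))
    2≤saturated : 2 ≤ neighboursIn G saturated x
    2≤saturated = +-cancelʳ-≤ 2 2 _ (begin
      3 + 1                                          ≤⟨ +-mono-≤ (3≤deg Sx) (witness (1 ≤? _) (∧-conicalʳ (S x) _ sp)) ⟩
      deg G x + neighboursIn G outer2 x              ≤⟨ deg+outer2≤saturated+deficiency Sx ⟩
      neighboursIn G saturated x + deficiency x      ≤⟨ +-monoʳ-≤ _ (deficiency≤2 Sx) ⟩
      neighboursIn G saturated x + 2                 ∎)

  local-outside : ∀ {x} → S x ≡ false → H x ≡ true → 28 + out x ≤ 10 * neighboursIn G H x + inn x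
  local-outside {x} Sx Hx = begin
    28 + out x                        ≡⟨ cong (28 +_) (outside⇒out≡0 Sx) ⟩
    28                                ≤⟨ by-s (s x ≟ 2) ⟩
    10 * s x + inn x                  ≤⟨ +-monoˡ-≤ (inn x) (*-monoʳ-≤ 10 s≤neighboursInH) ⟩
    10 * neighboursIn G H x + inn x   ∎
    where
    open ≤-Reasoning
    2≤s : 2 ≤ s x
    2≤s = witness (2 ≤? s x) (trans (sym (cong (_∨ ⌊ 2 ≤? s x ⌋) Sx)) Hx)
    s≤neighboursInH : s x ≤ neighboursIn G H x
    s≤neighboursInH = count-mono (adj G x ∩ S) (adj G x ∩ H)
      λ y h → cong₂ _∧_ (∧-conicalˡ (adj G x y) (S y) h) (S⊆H (∧-conicalʳ (adj G x y) (S y) h))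
    by-s : Dec (s x ≡ 2) → 28 ≤ 10 * s x + inn x
    by-s (yes s≡2) = begin
      10 * 2 + 4 * 2                  ≤⟨ +-monoʳ-≤ (10 * 2) (subst (λ k → 4 * k ≤ inn x) s≡2 (outer2⇒4s≤inn outer2x)) ⟩
      10 * 2 + inn x                  ≡⟨ cong (λ k → 10 * k + inn x) s≡2 ⟨
      10 * s x + inn x                ∎
      where
      outer2x : outer2 x ≡ true
      outer2x = cong₂ _∧_ (cong not Sx) (⌊⌋-true (s x ≟ 2) s≡2)
    by-s (no s≢2) = ≤-trans (≤-trans (n≤1+n 28) (n≤1+n 29)) (≤-trans (*-monoʳ-≤ 10 (≤∧≢⇒< 2≤s (s≢2 ∘ sym))) (m≤m+n _ (inn x)))

  local : ∀ x → 28 * 𝟙 (H x) + out x ≤ 10 * degreeIn G H x + inn x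
  local x = by-H (H x) refl
    where
    inside : S x ≡ true → ∀ b → sponsor x ≡ b → 28 + out x ≤ 10 * neighboursIn G H x + inn x
    inside Sx true  sp = local-sponsor Sx sp
    inside Sx false sp = local-sponsorless Sx sp
    in-H : H x ≡ true → ∀ b → S x ≡ b → 28 + out x ≤ 10 * neighboursIn G H x + inn x
    in-H Hx true  Sx = inside Sx (sponsor x) refl
    in-H Hx false Sx = local-outside Sx Hx
    by-H : ∀ b → H x ≡ b → 28 * 𝟙 b + out x ≤ 10 * degreeIn G H x + inn x
    by-H true  Hx = subst (λ d → 28 + out x ≤ 10 * d + inn x) (sym (degreeIn-of-member G H Hx)) (in-H Hx (S x) refl)
    by-H false Hx = ≤-trans (≤-reflexive (outside⇒out≡0 (∨-conicalˡ (S x) _ Hx))) z≤n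

  H-nonempty : 1 ≤ count S → 1 ≤ count H
  H-nonempty S≠∅ = ≤-trans S≠∅ (count-mono S H λ _ → S⊆H)

  H-dense : 28 * count H ≤ 10 * (2 * edgesIn G H)
  H-dense = begin
    28 * count H                          ≡⟨ *-distribˡ-sum 28 (𝟙 ∘ H) ⟩
    sum (λ x → 28 * 𝟙 (H x))              ≤⟨ sum-discharge _ (λ x → 10 * degreeIn G H x) transfer local ⟩
    sum (λ x → 10 * degreeIn G H x)       ≡⟨ *-distribˡ-sum 10 (degreeIn G H) ⟨
    10 * sum (degreeIn G H)               ≡⟨ cong (10 *_) (handshake G H) ⟨
    10 * (2 * edgesIn G H)                ∎
    where open ≤-Reasoning

dense-subgraph : ∀ {n} (G : Graph n) (S : Subset n) → (∀ v → deg G v ≤ 3) →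
  (∀ v → S v ≡ true → 7 ≤ sqNeighboursIn G S v) → 1 ≤ count S →
  ∃ λ H → 1 ≤ count H × 14 * count H ≤ 5 * (2 * edgesIn G H)
dense-subgraph G S deg≤3 S-sqdense S≠∅ =
  H , H-nonempty S≠∅ , *-cancelˡ-≤ 2 (subst₂ _≤_ (*-assoc 2 14 (count H)) (*-assoc 2 5 (2 * edgesIn G H)) H-dense)
  where open Discharging G S deg≤3 S-sqdense

square-degenerate : ∀ {n} (G : Graph n) → MaxDegree≤ G 3 → MadLessThan G 14 5 → Degenerate (adj² G) 6
square-degenerate G maxdeg mad S S≠∅
  with any? (λ v → (S v ≟𝔹 true) ×-dec (sqNeighboursIn G S v ≤? 6))
... | yes sparse-vertex = sparse-vertex
... | no  no-sparse-vertex =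
  let H , H≠∅ , H-dense = dense-subgraph G S deg≤3 S-sqdense S≠∅
  in  ⊥-elim (<⇒≱ (mad H (subst (1 ≤_) (sym (size≡count H)) H≠∅))
                  (subst (λ k → 14 * k ≤ 5 * (2 * edgesIn G H)) (sym (size≡count H)) H-dense))
  where
  deg≤3 : ∀ v → deg G v ≤ 3
  deg≤3 v = subst (_≤ 3) (size≡count (adj G v)) (maxdeg v)
  S-sqdense : ∀ v → S v ≡ true → 7 ≤ sqNeighboursIn G S v
  S-sqdense v Sv = ≰⇒> λ few → no-sparse-vertex (v , Sv , few)

theorem14 : ∀ {n : ℕ} (G : Graph n) → MaxDegree≤ G 3 → MadLessThan G 14 5 →
    ListChromaticSquare≤ G 7
theorem14 G maxdeg mad =
  greedy-choosable (adj² G) (adj²-sym G) (adj²-irrefl G) (square-degenerate G maxdeg mad)
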